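{- Let $r=\frac{1-\sqrt{1-4x}}{2x}$ and $s=\frac{1+\sqrt{1-4x}}{2x}$. Then \[ \sum_P \mathrm{first}(P)\,x^{\mathrm{col}(P)}=\frac{s}{r(s-1)^2}=\frac{1-\sqrt{1-4x}}{2x}-1, \] the sum running over all Stanley polyominoes $P$, and the coefficient of $x^n$ in this series is the Catalan number $C_n=\frac{1}{n+1}\binom{2n}{n}$. Consequently, the average number of cells in the first row among Stanley polyominoes with $n$ columns tends to $4$ as $n\to\infty$.
   Context: Cells are unit squares $[i,i+1]\times[j,j+1]$ with $i,j\in\mathbb{Z}$. A Stanley polyomino (up to translation) is a set of cells forming $k\geq 1$ rows $0,\dots,k-1$ (bottom to top), row $j$ consisting of the cells with $s_j\le i\le e_j$ ($s_j\le e_j$ integers), such that $s_{j-1}<s_j\le e_{j-1}<e_j$ for $1\le j\le k-1$. Here $\mathrm{col}(P)=e_{k-1}-s_0+1$ is the number of columns and $\mathrm{first}(P)=e_0-s_0+1$ is the number of cells in the first (bottom) row. -}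

module Defs where

open import Data.Nat using (ℕ; zero; suc; _+_; _*_; _∸_; _≤_; _<_; _/_)
open import Data.Nat.Combinatorics using (_C_)
open import Data.Product using (_×_; _,_)
open import Data.List using (List; []; _∷_; length; map)
open import Data.Nat.ListAction using (sum)
open import Data.List.Membership.Propositional using (_∈_)
open import Data.List.Relation.Unary.Unique.Propositional using (Unique)
open import Data.Empty using (⊥)
open import Data.Integer using (+_)
open import Function.Bundles using (_⇔_)
open import Relation.Binary.PropositionalEquality using (_≡_)
import Data.Rational as ℚ

-- A row is a pair (s , e): the cells with s ≤ i ≤ e.
Row : Set
Row = ℕ × ℕ

data Chain : Row → List Row → Set where
  done : ∀ {r} → Chain r []
  step : ∀ {s e s' e' rs} → s < s' → s' ≤ e → e < e' →
         Chain (s' , e') rs → Chain (s , e) ((s' , e') ∷ rs)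

-- A Stanley polyomino, normalised up to translation by s_0 = 0,
-- given as the list of its rows from bottom (row 0) to top (row k-1), k ≥ 1.
IsStanley : List Row → Set
IsStanley [] = ⊥
IsStanley ((s , e) ∷ rs) = (s ≡ 0) × Chain (s , e) rs

lastE : ℕ → List Row → ℕ
lastE e [] = e
lastE _ ((_ , e') ∷ rs) = lastE e' rs

col : List Row → ℕ
col [] = 0
col ((s , e) ∷ rs) = suc (lastE e rs) ∸ s

first : List Row → ℕ
first [] = 0
first ((s , e) ∷ _) = suc e ∸ s

Enumerates : ℕ → List (List Row) → Set
Enumerates n L = Unique L × (∀ P → (P ∈ L) ⇔ (IsStanley P × col P ≡ n))

catalan : ℕ → ℕ
catalan n = ((2 * n) C n) / suc n

-- coefficient of x^n in (1 - sqrt(1-4x))/(2x) - 1 = Σ_{n≥0} C_n x^n - 1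
gfCoeff : ℕ → ℕ
gfCoeff zero = 0
gfCoeff (suc n) = catalan (suc n)

firstTotal : List (List Row) → ℕ
firstTotal L = sum (map first L)

avg : ℕ → ℕ → ℚ.ℚ
avg a zero = ℚ.0ℚ
avg a (suc c) = (+ a) ℚ./ suc c

{-# OPTIONS --safe #-}
module Submission where

-- Read from the bottom up, a Stanley polyomino is a lattice path: the start of the next row moves
-- right through the current row one column at a time, then its end moves right past the current
-- end.  Counting these paths by the width w of the current row and the number m of columns still
-- to come gives ballot numbers, and the reflection principle yields
-- ballot (1 + v) m = C(2m+v, m) − C(2m+v, m+v+1).  So there are C_k polyominoes with k + 1
-- columns, and weighting each by its first row gives C_{k+1}.  The Catalan recurrence
-- (k+2) C_{k+1} = (4k+2) C_k then makes the average first row 4 − 6/(k+2).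

module Catalan where

  open import Defs using (catalan)
  open import Data.Nat using (ℕ; zero; suc; _+_; _*_; _∸_; _/_; _≤_; _<_; z<s)
  open import Data.Nat.Properties
  open import Data.Nat.Combinatorics using (_C_; nCk+nC[k+1]≡[n+1]C[k+1]; nC1≡n; k>n⇒nCk≡0)
  open import Data.Nat.DivMod using (m*n/n≡m)
  open import Data.Nat.Tactic.RingSolver using (solve-∀)
  open import Data.Product using (∃; _×_; _,_)
  open import Relation.Binary.PropositionalEquality
  open ≡-Reasoning

  [k+1]*[n+1]C[k+1]≡[n+1]*nCk : ∀ n k → suc k * (suc n C suc k) ≡ suc n * (n C k)
  [k+1]*[n+1]C[k+1]≡[n+1]*nCk zero zero = refl
  [k+1]*[n+1]C[k+1]≡[n+1]*nCk zero (suc k) = *-zeroʳ (suc (suc k))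
  [k+1]*[n+1]C[k+1]≡[n+1]*nCk (suc n) zero =
    trans (+-identityʳ _) (trans (nC1≡n (suc (suc n))) (sym (*-identityʳ (suc (suc n)))))
  [k+1]*[n+1]C[k+1]≡[n+1]*nCk (suc n) (suc k) = begin
    suc (suc k) * (suc (suc n) C suc (suc k))    ≡⟨ cong (suc (suc k) *_) (nCk+nC[k+1]≡[n+1]C[k+1] (suc n) (suc k)) ⟨
    suc (suc k) * (A + B)                        ≡⟨ expand k A B ⟩
    A + (suc k * A + suc (suc k) * B)            ≡⟨ cong (A +_) (cong₂ _+_ ([k+1]*[n+1]C[k+1]≡[n+1]*nCk n k)
                                                                         ([k+1]*[n+1]C[k+1]≡[n+1]*nCk n (suc k))) ⟩
    A + (suc n * (n C k) + suc n * (n C suc k))  ≡⟨ cong (A +_) (*-distribˡ-+ (suc n) (n C k) (n C suc k)) ⟨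
    A + suc n * (n C k + n C suc k)              ≡⟨ cong (λ x → A + suc n * x) (nCk+nC[k+1]≡[n+1]C[k+1] n k) ⟩
    A + suc n * A                                ∎
    where
    A = suc n C suc k
    B = suc n C suc (suc k)
    expand : ∀ k A B → suc (suc k) * (A + B) ≡ A + (suc k * A + suc (suc k) * B)
    expand = solve-∀

  [k+1]*[k+d]C[k+1]≡d*[k+d]Ck : ∀ k d → suc k * ((k + d) C suc k) ≡ d * ((k + d) C k)
  [k+1]*[k+d]C[k+1]≡d*[k+d]Ck k d = +-cancelˡ-≡ (suc k * X) _ _ (begin
    suc k * X + suc k * Y          ≡⟨ *-distribˡ-+ (suc k) X Y ⟨
    suc k * (X + Y)                ≡⟨ cong (suc k *_) (nCk+nC[k+1]≡[n+1]C[k+1] (k + d) k) ⟩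
    suc k * (suc (k + d) C suc k)  ≡⟨ [k+1]*[n+1]C[k+1]≡[n+1]*nCk (k + d) k ⟩
    (suc k + d) * X                ≡⟨ *-distribʳ-+ X (suc k) d ⟩
    suc k * X + d * X              ∎)
    where
    X = (k + d) C k
    Y = (k + d) C suc k

  ballot : ℕ → ℕ → ℕ
  ballot w zero = 1
  ballot zero (suc m) = 0
  ballot (suc w) (suc m) = ballot (suc (suc w)) m + ballot w (suc m)

  ballot-pos : ∀ w m → 0 < ballot (suc w) m
  ballot-pos w zero = z<s
  ballot-pos w (suc m) = ≤-trans (ballot-pos (suc w) m) (m≤m+n _ _)

  ballot-binomial : ∀ v m {n l} → n ≡ m + m + v → l ≡ suc (m + v) → ballot (suc v) m + n C l ≡ n C m
  ballot-binomial v zero refl refl = cong suc (k>n⇒nCk≡0 (n<1+n v))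
  ballot-binomial zero (suc j) {l = suc l} refl refl = begin
    (ballot 2 j + 0) + suc N C suc l        ≡⟨ cong ((ballot 2 j + 0) +_) (nCk+nC[k+1]≡[n+1]C[k+1] N l) ⟨
    (ballot 2 j + 0) + (N C l + N C suc l)  ≡⟨ shuffle (ballot 2 j) (N C l) (N C suc l) ⟩
    (ballot 2 j + N C suc l) + N C l        ≡⟨ cong₂ _+_ (ballot-binomial 1 j (index j) (cong suc (sym (+-suc j 0))))
                                                         (cong (N C_) (+-identityʳ (suc j))) ⟩
    N C j + N C suc j                       ≡⟨ nCk+nC[k+1]≡[n+1]C[k+1] N j ⟩
    suc N C suc j                           ∎
    where
    N = j + suc j + 0
    shuffle : ∀ a b c → (a + 0) + (b + c) ≡ (a + c) + b
    shuffle = solve-∀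
    index : ∀ j → j + suc j + 0 ≡ j + j + 1
    index = solve-∀
  ballot-binomial (suc u) (suc j) refl refl = begin
    ballot (2 + u) (suc j) + suc N C suc L  ≡⟨ cong (ballot (2 + u) (suc j) +_) (nCk+nC[k+1]≡[n+1]C[k+1] N L) ⟨
    (ballot (3 + u) j + ballot (suc u) (suc j)) + (N C L + N C suc L)
      ≡⟨ shuffle (ballot (3 + u) j) (ballot (suc u) (suc j)) (N C L) (N C suc L) ⟩
    (ballot (3 + u) j + N C suc L) + (ballot (suc u) (suc j) + N C L)
      ≡⟨ cong₂ _+_ (ballot-binomial (2 + u) j (index₁ j u) (cong suc (sym (+-suc j (suc u)))))
                   (ballot-binomial u (suc j) (index₂ j u) (cong suc (+-suc j u))) ⟩
    N C j + N C suc j                       ≡⟨ nCk+nC[k+1]≡[n+1]C[k+1] N j ⟩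
    suc N C suc j                           ∎
    where
    N = j + suc j + suc u
    L = suc (j + suc u)
    shuffle : ∀ a b c d → (a + b) + (c + d) ≡ (a + d) + (b + c)
    shuffle = solve-∀
    index₁ : ∀ j u → j + suc j + suc u ≡ j + j + suc (suc u)
    index₁ = solve-∀
    index₂ : ∀ j u → j + suc j + suc u ≡ suc j + suc j + u
    index₂ = solve-∀

  [n+1]*ballot[1,n]≡[n+n]Cn : ∀ n → suc n * ballot 1 n ≡ (n + n) C n
  [n+1]*ballot[1,n]≡[n+n]Cn n = +-cancelʳ-≡ (suc n * Y) _ _ (begin
    suc n * ballot 1 n + suc n * Y  ≡⟨ *-distribˡ-+ (suc n) (ballot 1 n) Y ⟨
    suc n * (ballot 1 n + Y)        ≡⟨ cong (suc n *_) (ballot-binomial 0 n (sym (+-identityʳ (n + n)))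
                                                                            (cong suc (sym (+-identityʳ n)))) ⟩
    suc n * X                       ≡⟨ cong (X +_) ([k+1]*[k+d]C[k+1]≡d*[k+d]Ck n n) ⟨
    X + suc n * Y                   ∎)
    where
    X = (n + n) C n
    Y = (n + n) C suc n

  catalan≡ballot : ∀ n → catalan n ≡ ballot 1 n
  catalan≡ballot n = begin
    ((2 * n) C n) / suc n         ≡⟨ cong (λ m → (m C n) / suc n) (cong (n +_) (+-identityʳ n)) ⟩
    ((n + n) C n) / suc n         ≡⟨ cong (_/ suc n) (trans (sym ([n+1]*ballot[1,n]≡[n+n]Cn n))
                                                             (*-comm (suc n) (ballot 1 n))) ⟩
    (ballot 1 n * suc n) / suc n  ≡⟨ m*n/n≡m (ballot 1 n) (suc n) ⟩
    ballot 1 n                    ∎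

  catalan-pos : ∀ n → 0 < catalan n
  catalan-pos n = subst (0 <_) (sym (catalan≡ballot n)) (ballot-pos 0 n)

  [n+1]*catalan≡[n+n]Cn : ∀ n → suc n * catalan n ≡ (n + n) C n
  [n+1]*catalan≡[n+n]Cn n = trans (cong (suc n *_) (catalan≡ballot n)) ([n+1]*ballot[1,n]≡[n+n]Cn n)

  catalan-recurrence : ∀ n → (2 + n) * catalan (suc n) ≡ (2 + 4 * n) * catalan n
  catalan-recurrence n = *-cancelˡ-≡ _ _ (suc n) (begin
    suc n * ((2 + n) * catalan (suc n))      ≡⟨ cong (suc n *_) ([n+1]*catalan≡[n+n]Cn (suc n)) ⟩
    suc n * (suc M C suc n)                  ≡⟨ cong (suc n *_) (nCk+nC[k+1]≡[n+1]C[k+1] M n) ⟨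
    suc n * (M C n + M C suc n)              ≡⟨ cong (λ x → suc n * (x + M C suc n)) symmetric ⟩
    suc n * (M C suc n + M C suc n)          ≡⟨ double (suc n) (M C suc n) ⟩
    2 * (suc n * (M C suc n))                ≡⟨ cong (λ m → 2 * (suc n * (m C suc n))) (+-suc n n) ⟩
    2 * (suc n * (suc (n + n) C suc n))      ≡⟨ cong (2 *_) ([k+1]*[n+1]C[k+1]≡[n+1]*nCk (n + n) n) ⟩
    2 * (suc (n + n) * ((n + n) C n))        ≡⟨ cong (λ x → 2 * (suc (n + n) * x)) ([n+1]*catalan≡[n+n]Cn n) ⟨
    2 * (suc (n + n) * (suc n * catalan n))  ≡⟨ regroup n (catalan n) ⟩
    suc n * ((2 + 4 * n) * catalan n)        ∎)
    where
    M = n + suc n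
    symmetric : M C n ≡ M C suc n
    symmetric = *-cancelˡ-≡ _ _ (suc n) (sym ([k+1]*[k+d]C[k+1]≡d*[k+d]Ck n (suc n)))
    double : ∀ a b → a * (b + b) ≡ 2 * (a * b)
    double = solve-∀
    regroup : ∀ n c → 2 * (suc (n + n) * (suc n * c)) ≡ suc n * ((2 + 4 * n) * c)
    regroup = solve-∀

  catalan-deficit : ∀ n → ∃ λ δ → catalan (suc n) + δ ≡ 4 * catalan n × (2 + n) * δ ≡ 6 * catalan n
  catalan-deficit n = δ , a+δ≡4b , [2+n]δ≡6b
    where
    a = catalan (suc n)
    b = catalan n
    split : ∀ n b → (2 + n) * (4 * b) ≡ (2 + 4 * n) * b + 6 * b
    split = solve-∀
    a≤4b : a ≤ 4 * b
    a≤4b = *-cancelˡ-≤ (2 + n) (≤-trans (≤-reflexive (catalan-recurrence n))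
                                (≤-trans (m≤m+n _ (6 * b)) (≤-reflexive (sym (split n b)))))
    δ = 4 * b ∸ a
    a+δ≡4b : a + δ ≡ 4 * b
    a+δ≡4b = m+[n∸m]≡n a≤4b
    [2+n]δ≡6b : (2 + n) * δ ≡ 6 * b
    [2+n]δ≡6b = +-cancelˡ-≡ ((2 + n) * a) _ _ (begin
      (2 + n) * a + (2 + n) * δ  ≡⟨ *-distribˡ-+ (2 + n) a δ ⟨
      (2 + n) * (a + δ)          ≡⟨ cong ((2 + n) *_) a+δ≡4b ⟩
      (2 + n) * (4 * b)          ≡⟨ split n b ⟩
      (2 + 4 * n) * b + 6 * b    ≡⟨ cong (_+ 6 * b) (catalan-recurrence n) ⟨
      (2 + n) * a + 6 * b        ∎)

module Enumeration where

  open import Defs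
  open Catalan using (ballot; catalan≡ballot)
  open import Data.Nat using (ℕ; zero; suc; _+_; _*_; _≤_; _<_; z≤n; z<s)
  open import Data.Nat.Properties
  open import Data.Nat.ListAction using (sum)
  open import Data.Nat.ListAction.Properties using (sum-++; sum-↭)
  open import Data.Nat.Tactic.RingSolver using (solve-∀)
  open import Data.Product using (_×_; _,_)
  open import Data.Sum using (inj₁; inj₂; [_,_]′)
  open import Data.Empty using (⊥-elim)
  open import Data.List using (List; []; _∷_; map; _++_; length)
  open import Data.List.Properties using (∷-injectiveʳ; length-++; length-map; map-++)
  open import Data.List.Membership.Propositional using (_∈_)
  open import Data.List.Membership.Propositional.Properties using (∈-++⁺ˡ; ∈-++⁺ʳ; ∈-++⁻; ∈-map⁺; ∈-map⁻)
  open import Data.List.Membership.Propositional.Properties.WithK using (unique∧set⇒bag)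
  open import Data.List.Relation.Unary.Any using (here)
  open import Data.List.Relation.Unary.All using ([])
  open import Data.List.Relation.Unary.AllPairs using ([]; _∷_)
  open import Data.List.Relation.Unary.Unique.Propositional using (Unique)
  open import Data.List.Relation.Unary.Unique.Propositional.Properties using (++⁺; map⁺)
  open import Data.List.Relation.Binary.Disjoint.Propositional using (Disjoint)
  open import Data.List.Relation.Binary.BagAndSetEquality using (∼bag⇒↭)
  open import Data.List.Relation.Binary.Permutation.Propositional using (_↭_)
  open import Data.List.Relation.Binary.Permutation.Propositional.Properties as ↭ using (↭-length)
  open import Function.Bundles using (mk⇔)
  import Function.Properties.Equivalence as ⇔
  open import Relation.Binary.PropositionalEquality
  open ≡-Reasoning

  ChainTo : Row → ℕ → List Row → Set
  ChainTo (s , e) t rs = Chain (s , e) rs × lastE e rs ≡ t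

  data HeadFrom (s e t : ℕ) : List Row → Set where
    head : ∀ {s′ e′ rs} → s′ ≡ s → e ≤ e′ → ChainTo (s′ , e′) t rs → HeadFrom s e t ((s′ , e′) ∷ rs)

  -- above a w m lists the chains above the row (a , a + w) that end at column a + w + m, and
  -- headFrom s w m the lists satisfying HeadFrom s (s + w) (s + w + m).  One step either moves the
  -- next row's start right (above) or the end of the first row right (headFrom).
  mutual
    above : ℕ → ℕ → ℕ → List (List Row)
    above a w zero = [] ∷ []
    above a zero (suc m) = []
    above a (suc w) (suc m) = headFrom (suc a) (suc w) m ++ above (suc a) w (suc m)

    headFrom : ℕ → ℕ → ℕ → List (List Row)
    headFrom s w zero = map ((s , s + w) ∷_) (above s w zero)
    headFrom s w (suc m) = map ((s , s + w) ∷_) (above s w (suc m)) ++ headFrom s (suc w) m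

  ≤-lastE : ∀ {s e} rs → Chain (s , e) rs → e ≤ lastE e rs
  ≤-lastE [] done = ≤-refl
  ≤-lastE (_ ∷ rs) (step _ _ e<e′ ch) = ≤-trans (<⇒≤ e<e′) (≤-lastE rs ch)

  <-lastE : ∀ {s e r rs} → Chain (s , e) (r ∷ rs) → e < lastE e (r ∷ rs)
  <-lastE {rs = rs} (step _ _ e<e′ ch) = <-≤-trans e<e′ (≤-lastE rs ch)

  chain-lower : ∀ {a b e rs} → a ≤ b → Chain (b , e) rs → Chain (a , e) rs
  chain-lower a≤b done = done
  chain-lower a≤b (step b<s′ s′≤e e<e′ ch) = step (≤-<-trans a≤b b<s′) s′≤e e<e′ ch

  ∈-map-∷⁺ : ∀ {A : Set} {x y : A} {xs : List A} {xss} → x ≡ y → xs ∈ xss → (y ∷ xs) ∈ map (x ∷_) xss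
  ∈-map-∷⁺ refl = ∈-map⁺ _

  mutual
    ∈-above⁻ : ∀ a w m {e t P} → a + w ≡ e → e + m ≡ t → P ∈ above a w m → ChainTo (a , e) t P
    ∈-above⁻ a w zero refl refl (here refl) = done , sym (+-identityʳ (a + w))
    ∈-above⁻ a (suc w) (suc m) refl refl P∈ with ∈-++⁻ (headFrom (suc a) (suc w) m) P∈
    ... | inj₁ P∈h with ∈-headFrom⁻ (suc a) (suc w) m refl (sym (+-suc (a + suc w) m)) P∈h
    ...   | head refl e< (ch , top) = step ≤-refl (m<m+n a z<s) e< ch , top
    ∈-above⁻ a (suc w) (suc m) refl refl P∈ | inj₂ P∈a
      with ∈-above⁻ (suc a) w (suc m) (sym (+-suc a w)) refl P∈a
    ... | ch , top = chain-lower (n≤1+n a) ch , top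

    ∈-headFrom⁻ : ∀ s w m {e t P} → s + w ≡ e → e + m ≡ t → P ∈ headFrom s w m → HeadFrom s e t P
    ∈-headFrom⁻ s w zero refl refl P∈ with ∈-map⁻ ((s , s + w) ∷_) P∈
    ... | rs , rs∈ , refl = head refl ≤-refl (∈-above⁻ s w zero refl refl rs∈)
    ∈-headFrom⁻ s w (suc m) refl refl P∈ with ∈-++⁻ (map ((s , s + w) ∷_) (above s w (suc m))) P∈
    ... | inj₁ P∈m with ∈-map⁻ ((s , s + w) ∷_) P∈m
    ...   | rs , rs∈ , refl = head refl ≤-refl (∈-above⁻ s w (suc m) refl refl rs∈)
    ∈-headFrom⁻ s w (suc m) refl refl P∈ | inj₂ P∈h
      with ∈-headFrom⁻ s (suc w) m (+-suc s w) (sym (+-suc (s + w) m)) P∈h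
    ... | head refl e< ch = head refl (<⇒≤ e<) ch

  -- The case splits use [_,_]′ on plain lambdas: a with-clause would pass m instead of suc m to
  -- its auxiliary function, and the termination checker would lose the decrease.
  mutual
    ∈-above⁺ : ∀ a w m {e t P} → a + w ≡ e → e + m ≡ t → ChainTo (a , e) t P → P ∈ above a w m
    ∈-above⁺ a w zero refl refl (done , _) = here refl
    ∈-above⁺ a w zero refl refl (ch@(step _ _ _ _) , top) =
      ⊥-elim (<-irrefl (sym (trans top (+-identityʳ (a + w)))) (<-lastE ch))
    ∈-above⁺ a w (suc m) refl refl (done , top) = ⊥-elim (m+1+n≰m (a + w) (≤-reflexive (sym top)))
    ∈-above⁺ a zero (suc m) refl refl (step a<s′ s′≤e _ _ , _) =
      ⊥-elim (<⇒≱ a<s′ (≤-trans s′≤e (≤-reflexive (+-identityʳ a))))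
    ∈-above⁺ a (suc w) (suc m) refl refl (step a<s′ s′≤e e<e′ ch , top) =
      [ (λ 1+a<s′ → ∈-++⁺ʳ (headFrom (suc a) (suc w) m)
            (∈-above⁺ (suc a) w (suc m) (sym (+-suc a w)) refl (step 1+a<s′ s′≤e e<e′ ch , top)))
      , (λ 1+a≡s′ → ∈-++⁺ˡ (∈-headFrom⁺ (suc a) (suc w) m refl (sym (+-suc (a + suc w) m))
            (head (sym 1+a≡s′) e<e′ (ch , top))))
      ]′ (m≤n⇒m<n∨m≡n a<s′)

    ∈-headFrom⁺ : ∀ s w m {e t P} → s + w ≡ e → e + m ≡ t → HeadFrom s e t P → P ∈ headFrom s w m
    ∈-headFrom⁺ s w zero refl refl (head refl e≤e′ (ch , top)) =
      [ (λ e<e′ → ⊥-elim (<-irrefl (sym (trans top (+-identityʳ (s + w)))) (<-≤-trans e<e′ (≤-lastE _ ch))))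
      , (λ e≡e′ → ∈-map-∷⁺ (cong (s ,_) e≡e′) (∈-above⁺ s w zero e≡e′ (cong (_+ zero) (sym e≡e′)) (ch , top)))
      ]′ (m≤n⇒m<n∨m≡n e≤e′)
    ∈-headFrom⁺ s w (suc m) refl refl (head refl e≤e′ (ch , top)) =
      [ (λ e<e′ → ∈-++⁺ʳ (map ((s , s + w) ∷_) (above s w (suc m)))
            (∈-headFrom⁺ s (suc w) m (+-suc s w) (sym (+-suc (s + w) m)) (head refl e<e′ (ch , top))))
      , (λ e≡e′ → ∈-++⁺ˡ (∈-map-∷⁺ (cong (s ,_) e≡e′)
            (∈-above⁺ s w (suc m) e≡e′ (cong (_+ suc m) (sym e≡e′)) (ch , top))))
      ]′ (m≤n⇒m<n∨m≡n e≤e′)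

  mutual
    above-unique : ∀ a w m → Unique (above a w m)
    above-unique a w zero = [] ∷ []
    above-unique a zero (suc m) = []
    above-unique a (suc w) (suc m) =
      ++⁺ (headFrom-unique (suc a) (suc w) m) (above-unique (suc a) w (suc m)) starts-differ
      where
      starts-differ : Disjoint (headFrom (suc a) (suc w) m) (above (suc a) w (suc m))
      starts-differ (P∈h , P∈a)
        with ∈-headFrom⁻ (suc a) (suc w) m refl refl P∈h | ∈-above⁻ (suc a) w (suc m) refl refl P∈a
      ... | head refl _ _ | step a<a _ _ _ , _ = <-irrefl refl a<a

    headFrom-unique : ∀ s w m → Unique (headFrom s w m)
    headFrom-unique s w zero = [] ∷ []
    headFrom-unique s w (suc m) =
      ++⁺ (map⁺ (λ eq → ∷-injectiveʳ eq) (above-unique s w (suc m))) (headFrom-unique s (suc w) m) ends-differ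
      where
      ends-differ : Disjoint (map ((s , s + w) ∷_) (above s w (suc m))) (headFrom s (suc w) m)
      ends-differ (P∈m , P∈h) with ∈-map⁻ ((s , s + w) ∷_) P∈m
      ... | _ , _ , refl with ∈-headFrom⁻ s (suc w) m (+-suc s w) refl P∈h
      ...   | head _ e≤ _ = <-irrefl refl e≤

  stanley : ℕ → List (List Row)
  stanley zero = []
  stanley (suc k) = headFrom 0 0 k

  ∈-stanley⁻ : ∀ {n P} → P ∈ stanley n → IsStanley P × col P ≡ n
  ∈-stanley⁻ {suc k} P∈ with ∈-headFrom⁻ 0 0 k refl refl P∈
  ... | head refl _ (ch , top) = (refl , ch) , cong suc top

  ∈-stanley⁺ : ∀ {n P} → IsStanley P × col P ≡ n → P ∈ stanley n
  ∈-stanley⁺ {P = (_ , e) ∷ rs} ((refl , ch) , refl) =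
    ∈-headFrom⁺ 0 0 (lastE e rs) refl refl (head refl z≤n (ch , refl))

  stanley-unique : ∀ n → Unique (stanley n)
  stanley-unique zero = []
  stanley-unique (suc k) = headFrom-unique 0 0 k

  stanley-enumerates : ∀ n → Enumerates n (stanley n)
  stanley-enumerates n = stanley-unique n , λ P → mk⇔ ∈-stanley⁻ ∈-stanley⁺

  enumerations-↭ : ∀ {n L L′} → Enumerates n L → Enumerates n L′ → L ↭ L′
  enumerations-↭ (L! , ∈L⇔) (L′! , ∈L′⇔) =
    ∼bag⇒↭ (unique∧set⇒bag L! L′! (λ {P} → ⇔.trans (∈L⇔ P) (⇔.sym (∈L′⇔ P))))

  mutual
    length-above : ∀ a w m → length (above a w m) ≡ ballot w m
    length-above a w zero = refl
    length-above a zero (suc m) = refl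
    length-above a (suc w) (suc m) = begin
      length (headFrom (suc a) (suc w) m ++ above (suc a) w (suc m))
        ≡⟨ length-++ (headFrom (suc a) (suc w) m) ⟩
      length (headFrom (suc a) (suc w) m) + length (above (suc a) w (suc m))
        ≡⟨ cong₂ _+_ (length-headFrom (suc a) (suc w) m) (length-above (suc a) w (suc m)) ⟩
      ballot (suc (suc w)) m + ballot w (suc m) ∎

    length-headFrom : ∀ s w m → length (headFrom s w m) ≡ ballot (suc w) m
    length-headFrom s w zero = refl
    length-headFrom s w (suc m) = begin
      length (map ((s , s + w) ∷_) (above s w (suc m)) ++ headFrom s (suc w) m)
        ≡⟨ length-++ (map ((s , s + w) ∷_) (above s w (suc m))) ⟩
      length (map ((s , s + w) ∷_) (above s w (suc m))) + length (headFrom s (suc w) m)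
        ≡⟨ cong₂ _+_ (trans (length-map _ (above s w (suc m))) (length-above s w (suc m)))
                     (length-headFrom s (suc w) m) ⟩
      ballot w (suc m) + ballot (suc (suc w)) m
        ≡⟨ +-comm (ballot w (suc m)) _ ⟩
      ballot (suc w) (suc m) ∎

  firstTotal-++ : ∀ Ps Qs → firstTotal (Ps ++ Qs) ≡ firstTotal Ps + firstTotal Qs
  firstTotal-++ Ps Qs = trans (cong sum (map-++ first Ps Qs)) (sum-++ (map first Ps) (map first Qs))

  firstTotal-map-∷ : ∀ r Ps → firstTotal (map (r ∷_) Ps) ≡ first (r ∷ []) * length Ps
  firstTotal-map-∷ r [] = sym (*-zeroʳ (first (r ∷ [])))
  firstTotal-map-∷ r (P ∷ Ps) =
    trans (cong (first (r ∷ []) +_) (firstTotal-map-∷ r Ps)) (sym (*-suc (first (r ∷ [])) (length Ps)))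

  firstTotal-↭ : ∀ {L L′} → L ↭ L′ → firstTotal L ≡ firstTotal L′
  firstTotal-↭ L↭L′ = sum-↭ (↭.map⁺ first L↭L′)

  firstTotal-headFrom : ∀ w m → firstTotal (headFrom 0 w m) ≡ w * ballot (suc w) m + ballot (2 + w) m
  firstTotal-headFrom w zero = one-row w
    where
    one-row : ∀ w → suc w + 0 ≡ w * 1 + 1
    one-row = solve-∀
  firstTotal-headFrom w (suc m) = begin
    firstTotal (map ((0 , w) ∷_) (above 0 w (suc m)) ++ headFrom 0 (suc w) m)
      ≡⟨ firstTotal-++ (map ((0 , w) ∷_) (above 0 w (suc m))) (headFrom 0 (suc w) m) ⟩
    firstTotal (map ((0 , w) ∷_) (above 0 w (suc m))) + firstTotal (headFrom 0 (suc w) m)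
      ≡⟨ cong₂ _+_ (trans (firstTotal-map-∷ (0 , w) (above 0 w (suc m))) (cong (suc w *_) (length-above 0 w (suc m))))
                   (firstTotal-headFrom (suc w) m) ⟩
    suc w * ballot w (suc m) + (suc w * ballot (2 + w) m + ballot (3 + w) m)
      ≡⟨ regroup w (ballot w (suc m)) (ballot (2 + w) m) (ballot (3 + w) m) ⟩
    w * (ballot (2 + w) m + ballot w (suc m)) + (ballot (3 + w) m + (ballot (2 + w) m + ballot w (suc m))) ∎
    where
    regroup : ∀ w b₀ b₂ b₃ → suc w * b₀ + (suc w * b₂ + b₃) ≡ w * (b₂ + b₀) + (b₃ + (b₂ + b₀))
    regroup = solve-∀

  firstTotal-enumeration : ∀ {n L} → Enumerates n L → firstTotal L ≡ gfCoeff n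
  firstTotal-enumeration {zero} L-enum = firstTotal-↭ (enumerations-↭ L-enum (stanley-enumerates zero))
  firstTotal-enumeration {suc k} {L} L-enum = begin
    firstTotal L                  ≡⟨ firstTotal-↭ (enumerations-↭ L-enum (stanley-enumerates (suc k))) ⟩
    firstTotal (headFrom 0 0 k)   ≡⟨ firstTotal-headFrom 0 k ⟩
    ballot 2 k                    ≡⟨ +-identityʳ (ballot 2 k) ⟨
    ballot 1 (suc k)              ≡⟨ catalan≡ballot (suc k) ⟨
    catalan (suc k)               ∎

  length-enumeration : ∀ {k L} → Enumerates (suc k) L → length L ≡ catalan k
  length-enumeration {k} L-enum =
    trans (↭-length (enumerations-↭ L-enum (stanley-enumerates (suc k))))
          (trans (length-headFrom 0 0 k) (sym (catalan≡ballot k)))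

module Limit where

  open import Defs using (avg; catalan)
  open Catalan using (catalan-pos; catalan-deficit)
  open import Data.Nat as ℕ using (ℕ; zero; suc; _≥_)
  import Data.Nat.Properties as ℕP
  import Data.Nat.Tactic.RingSolver as ℕSolver
  open import Data.Nat.Coprimality using (Coprime)
  open import Data.Integer as ℤ using (+_; +[1+_]; -[1+_])
  import Data.Integer.Properties as ℤP
  import Data.Integer.Tactic.RingSolver as ℤSolver
  open import Data.Rational using (ℚ; mkℚ; 0ℚ; _<_; _-_; -_; ∣_∣; _/_; toℚᵘ; *<*)
  import Data.Rational.Properties as ℚP
  open import Data.Rational.Unnormalised as ℚᵘ using (mkℚᵘ; _≃_; *≡*)
  import Data.Rational.Unnormalised.Properties as ℚᵘP
  open import Data.Product using (∃; _,_)
  open import Relation.Binary.PropositionalEquality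

  avg-4≃-deficit : ∀ a c δ → a ℕ.+ δ ≡ 4 ℕ.* suc c →
                   toℚᵘ (avg a (suc c) - (+ 4) / 1) ≃ ℚᵘ.- mkℚᵘ (+ δ) c
  avg-4≃-deficit a c δ a+δ≡4b = ℚᵘP.≃-trans
    (ℚᵘP.≃-trans (ℚP.toℚᵘ-homo-+ (avg a (suc c)) (- ((+ 4) / 1)))
                 (ℚᵘP.+-cong (ℚP.toℚᵘ-fromℚᵘ (mkℚᵘ (+ a) c)) ℚᵘP.≃-refl))
    (*≡* (begin
      (+ a ℤ.* + 1 ℤ.+ -[1+ 3 ] ℤ.* b) ℤ.* b                  ≡⟨ cong (λ x → (x ℤ.* + 1 ℤ.+ -[1+ 3 ] ℤ.* b) ℤ.* b) a≡4b-δ ⟩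
      ((b ℤ.* + 4 ℤ.- + δ) ℤ.* + 1 ℤ.+ -[1+ 3 ] ℤ.* b) ℤ.* b  ≡⟨ cancel (+ δ) b ⟩
      ℤ.- (+ δ) ℤ.* b                                         ≡⟨ cong (λ d → ℤ.- (+ δ) ℤ.* + suc d) (ℕP.*-identityʳ c) ⟨
      ℤ.- (+ δ) ℤ.* + suc (c ℕ.* 1)                           ∎))
    where
    open ≡-Reasoning
    b = + suc c
    cancel : ∀ d b → ((b ℤ.* + 4 ℤ.- d) ℤ.* + 1 ℤ.+ -[1+ 3 ] ℤ.* b) ℤ.* b ≡ ℤ.- d ℤ.* b
    cancel = ℤSolver.solve-∀
    move : ∀ x d → x ≡ (x ℤ.+ d) ℤ.- d
    move = ℤSolver.solve-∀
    a≡4b-δ : + a ≡ b ℤ.* + 4 ℤ.- + δ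
    a≡4b-δ = trans (move (+ a) (+ δ)) (cong (ℤ._- + δ) (begin
      + a ℤ.+ + δ      ≡⟨ ℤP.pos-+ a δ ⟨
      + (a ℕ.+ δ)      ≡⟨ cong +_ (trans a+δ≡4b (ℕP.*-comm 4 (suc c))) ⟩
      + (suc c ℕ.* 4)  ≡⟨ ℤP.pos-* (suc c) 4 ⟩
      b ℤ.* + 4        ∎))

  ∣avg-4∣<ε : ∀ {a b δ} p q .(cop : Coprime (suc p) (suc q)) → 0 ℕ.< b → a ℕ.+ δ ≡ 4 ℕ.* b →
              δ ℕ.* suc q ℕ.< suc p ℕ.* b → ∣ avg a b - (+ 4) / 1 ∣ < mkℚ +[1+ p ] q cop
  ∣avg-4∣<ε {a} {suc c} {δ} p q cop _ a+δ≡4b δq<pb =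
    ℚP.toℚᵘ-cancel-< (ℚᵘP.<-respˡ-≃ (ℚᵘP.≃-sym ∣avg-4∣≃δ/b) δ/b<ε)
    where
    ∣avg-4∣≃δ/b : toℚᵘ ∣ avg a (suc c) - (+ 4) / 1 ∣ ≃ mkℚᵘ (+ δ) c
    ∣avg-4∣≃δ/b = ℚᵘP.≃-trans (ℚP.toℚᵘ-homo-∣-∣ (avg a (suc c) - (+ 4) / 1))
                   (ℚᵘP.≃-trans (ℚᵘP.∣-∣-cong (avg-4≃-deficit a c δ a+δ≡4b)) (ℚᵘP.∣-p∣≃∣p∣ (mkℚᵘ (+ δ) c)))
    δ/b<ε : mkℚᵘ (+ δ) c ℚᵘ.< mkℚᵘ +[1+ p ] q
    δ/b<ε = ℚᵘ.*<* (subst₂ ℤ._<_ (ℤP.pos-* δ (suc q)) (ℤP.pos-* (suc p) (suc c)) (ℤ.+<+ δq<pb))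

  deficit-bound : ∀ j b δ p q → 0 ℕ.< b → (2 ℕ.+ j) ℕ.* δ ≡ 6 ℕ.* b → 6 ℕ.* suc q ℕ.< 2 ℕ.+ j →
                  δ ℕ.* suc q ℕ.< suc p ℕ.* b
  deficit-bound j b δ p q 0<b [2+j]δ≡6b 6q<2+j = ℕP.*-cancelˡ-< (2 ℕ.+ j) _ _ (begin-strict
    (2 ℕ.+ j) ℕ.* (δ ℕ.* suc q)                ≡⟨ ℕP.*-assoc (2 ℕ.+ j) δ (suc q) ⟨
    (2 ℕ.+ j) ℕ.* δ ℕ.* suc q                  ≡⟨ cong (ℕ._* suc q) [2+j]δ≡6b ⟩
    6 ℕ.* b ℕ.* suc q                          ≡⟨ swap b (suc q) ⟩
    b ℕ.* (6 ℕ.* suc q)                        <⟨ ℕP.*-monoʳ-< b {{ℕ.>-nonZero 0<b}} 6q<2+j ⟩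
    b ℕ.* (2 ℕ.+ j)                            ≤⟨ ℕP.m≤m+n _ _ ⟩
    b ℕ.* (2 ℕ.+ j) ℕ.+ p ℕ.* b ℕ.* (2 ℕ.+ j)  ≡⟨ collect j p b ⟩
    (2 ℕ.+ j) ℕ.* (suc p ℕ.* b)                ∎)
    where
    open ℕP.≤-Reasoning
    swap : ∀ b q → 6 ℕ.* b ℕ.* q ≡ b ℕ.* (6 ℕ.* q)
    swap = ℕSolver.solve-∀
    collect : ∀ j p b → b ℕ.* (2 ℕ.+ j) ℕ.+ p ℕ.* b ℕ.* (2 ℕ.+ j) ≡ (2 ℕ.+ j) ℕ.* (suc p ℕ.* b)
    collect = ℕSolver.solve-∀

  catalan-ratio→4 : (ε : ℚ) → 0ℚ < ε → ∃ λ N → ∀ n → n ≥ N →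
                    ∣ avg (catalan (suc n)) (catalan n) - (+ 4) / 1 ∣ < ε
  catalan-ratio→4 (mkℚ (+ zero) _ _) (*<* (ℤ.+<+ ()))
  catalan-ratio→4 (mkℚ -[1+ _ ] _ _) (*<* ())
  catalan-ratio→4 (mkℚ +[1+ p ] q cop) _ = 6 ℕ.* suc q , close
    where
    close : ∀ n → n ≥ 6 ℕ.* suc q → ∣ avg (catalan (suc n)) (catalan n) - (+ 4) / 1 ∣ < mkℚ +[1+ p ] q cop
    close n n≥6q =
      let δ , a+δ≡4b , [2+n]δ≡6b = catalan-deficit n
      in ∣avg-4∣<ε p q cop (catalan-pos n) a+δ≡4b
           (deficit-bound n (catalan n) δ p q (catalan-pos n) [2+n]δ≡6b (ℕP.≤-<-trans n≥6q (ℕP.m<n+m n ℕ.z<s)))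

open import Defs
open import Data.Nat using (ℕ; _≥_; suc; s≤s)
open import Data.Product using (_×_; ∃; _,_)
open import Data.List using (List; length)
open import Data.Rational using (ℚ; 0ℚ; _<_; _-_; ∣_∣; _/_)
open import Data.Integer using (+_)
open import Relation.Binary.PropositionalEquality using (_≡_; sym; subst₂)
open Enumeration using (stanley; stanley-enumerates; firstTotal-enumeration; length-enumeration)
open Limit using (catalan-ratio→4)

corollary2p3 :
  ((n : ℕ) → ∃ (Enumerates n))
  × ((n : ℕ) (L : List (List Row)) → Enumerates n L → firstTotal L ≡ gfCoeff n)
  × ((ε : ℚ) → 0ℚ < ε → ∃ λ (N : ℕ) → (n : ℕ) → n ≥ N →
      (L : List (List Row)) → Enumerates n L →
      ∣ avg (firstTotal L) (length L) - (+ 4) / 1 ∣ < ε)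
corollary2p3 = (λ n → stanley n , stanley-enumerates n) , (λ _ _ → firstTotal-enumeration) , average→4
  where
  average→4 : (ε : ℚ) → 0ℚ < ε → ∃ λ (N : ℕ) → (n : ℕ) → n ≥ N →
              (L : List (List Row)) → Enumerates n L → ∣ avg (firstTotal L) (length L) - (+ 4) / 1 ∣ < ε
  average→4 ε 0<ε =
    let N , close = catalan-ratio→4 ε 0<ε
    in suc N , λ where
      (suc k) (s≤s k≥N) L L-enum → subst₂ (λ a b → ∣ avg a b - (+ 4) / 1 ∣ < ε)
        (sym (firstTotal-enumeration L-enum)) (sym (length-enumeration L-enum)) (close k k≥N)
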